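{- Let $(\mathcal{U},\preceq)$ be a finite tree-like partially ordered universe with minimum element $\nu$, let $S\subseteq\mathcal{U}$ with $\nu\in S$, and let $\mathcal{T}$ be a Line-Leaf Tree built from $S$. Then on any root-to-leaf path of $\mathcal{T}$ (i.e. any sequence of component search structures visited by the search procedure), for each iteration $i$ of the construction there is at most one binary search tree created in iteration $i$ and at most one linear search tree $LST(x)$ of a node $x$ contracted in iteration $i$.
   Context: The Hasse diagram $H_S$ of $S$ is the directed graph on $S$ with an edge $x\to y$ iff $x\prec y$ and no $z\in S$ satisfies $x\prec z\prec y$; $\mathcal{U}$ is tree-like if $H_{\mathcal{U}}$ is a rooted oriented tree. $T_S$ is $H_S$ with orientations ignored. Dynamic edge query: for $x,y\in S$, $u\in\mathcal{U}$, let $S'=S\cup\{u\}$ and let $(x,x')$, $(y',y)$ be the first and last edges on the path from $x$ to $y$ in $T_{S'}$; removing them splits $T_{S'}$ into the component containing $x$, the one containing $y$, and the one containing neither; the query $(x,y)$ w.r.t. $u$ answers X, Y or HERE accordingly. Line-Leaf Tree construction: initially each edge $\{x,y\}$ of $T_S$ carries an empty balanced binary search tree $BST(x,y)$ and each node $x$ has a linear search tree $LST(x)$ consisting only of $x$. Starting from $T_S$, iteration $i=1,2,\dots$ performs: (Line contraction) every maximal path $x_1,\dots,x_t$ ($t\ge3$) of the current tree whose interior nodes have degree 2 and whose endpoints do not is replaced by an edge $\{x_1,x_t\}$ carrying a balanced binary search tree $BST(x_1,x_t)$ over $x_2,\dots,x_{t-1}$ (created in iteration $i$) that binary-searches the path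 with dynamic edge queries; (Leaf contraction) for every node $x$, all its degree-1 neighbours $y$ are removed and the query $(x,y)$ is added to the front of $LST(x)$ (if only one edge remains, one endpoint is arbitrarily kept). Nodes removed in iteration $i$ are contracted in iteration $i$. The process stops when one node $r$ remains; the Line-Leaf Tree is rooted at $LST(r)$. Search: in $LST(x)$ queries are asked in order; answer X moves to the next query, HERE on $(x,y)$ moves to $BST(x,y)$, Y moves to $LST(y)$; when queries are exhausted, $x$ is returned. In $BST(x,y)$ a binary search with dynamic edge queries is performed; HERE on a query $(a,b)$ moves to $BST(a,b)$; ending at node $z$ moves to $LST(z)$; an empty BST returns Nil. -}

module Defs where

open import Level using (0ℓ)
open import Data.Nat using (ℕ; zero; suc)
open import Data.Fin using (Fin)
open import Data.Fin.Subset using (Subset) renaming (_∈_ to _∈ₛ_)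
open import Data.List using (List; []; _∷_; _++_; length; lookup)
open import Data.List.Membership.Propositional using (_∈_)
open import Data.List.Relation.Unary.Any using (Any)
open import Data.List.Relation.Unary.All using (All)
open import Data.List.Relation.Unary.Linked using (Linked)
open import Data.List.Relation.Unary.Unique.Propositional using (Unique)
open import Data.Product using (Σ; ∃; _×_; _,_)
open import Data.Sum using (_⊎_)
open import Function.Bundles using (_⇔_)
open import Relation.Binary.Core using (Rel)
open import Relation.Binary.PropositionalEquality using (_≡_; _≢_)
open import Relation.Nullary using (¬_)

module _ {n : ℕ} where

  U : Set
  U = Fin n

  _≺[_]_ : U → Rel U 0ℓ → U → Set
  x ≺[ R ] y = R x y × x ≢ y

  HasseEdge : Rel U 0ℓ → Subset n → U → U → Set
  HasseEdge R S x y =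
    x ∈ₛ S × y ∈ₛ S × x ≺[ R ] y ×
    ¬ (Σ U λ z → z ∈ₛ S × x ≺[ R ] z × z ≺[ R ] y)

  HasseU : Rel U 0ℓ → U → U → Set
  HasseU R x y = x ≺[ R ] y × ¬ (Σ U λ z → x ≺[ R ] z × z ≺[ R ] y)

  DWalk : (U → U → Set) → U → U → List U → Set
  DWalk E a b vs = Σ (List U) λ ws → vs ≡ a ∷ ws × Linked E vs × LastIs vs
    where
    LastIs : List U → Set
    LastIs [] = Data.Empty.⊥ where import Data.Empty
    LastIs (v ∷ []) = v ≡ b
    LastIs (_ ∷ w ∷ ws) = LastIs (w ∷ ws)

  RootedOrientedTree : (U → U → Set) → Set
  RootedOrientedTree E =
    Σ U λ r → (v : U) →
      Σ (List U) (DWalk E r v) ×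
      ((ps qs : List U) → DWalk E r v ps → DWalk E r v qs → ps ≡ qs)

  TreeLike : Rel U 0ℓ → Set
  TreeLike R = RootedOrientedTree (HasseU R)

  -- A (binary) search tree whose internal nodes are dynamic edge queries.
  --   nil       : empty (returns Nil)
  --   node z    : search ends at node z (move to LST(z))
  --   ask a b l r : query (a,b); X → l, Y → r, HERE → BST(a,b)
  data SearchTree : Set where
    nil  : SearchTree
    node : U → SearchTree
    ask  : U → U → SearchTree → SearchTree → SearchTree

  -- the same tree seen from the other endpoint of its edge
  mirror : SearchTree → SearchTree
  mirror nil = nil
  mirror (node z) = node z
  mirror (ask a b l r) = ask b a (mirror r) (mirror l)

  data Item : Set where
    vtx : U → Item
    edg : U → U → Item

  items : U → List U → U → List Item
  items a [] b = edg a b ∷ []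
  items a (m ∷ ms) b = edg a m ∷ vtx m ∷ items m ms b

  #vtx : List Item → ℕ
  #vtx [] = 0
  #vtx (vtx _ ∷ is) = suc (#vtx is)
  #vtx (edg _ _ ∷ is) = #vtx is

  Close : ℕ → ℕ → Set
  Close a b = (a Data.Nat.≤ suc b) × (b Data.Nat.≤ suc a)
    where import Data.Nat

  -- balanced binary search tree over a sequence of items (binary search
  -- on the path with dynamic edge queries; at each query the numbers of
  -- path nodes on both sides differ by at most one)
  data BalancedBST : List Item → SearchTree → Set where
    bs-nil  : BalancedBST [] nil
    bs-node : ∀ z → BalancedBST (vtx z ∷ []) (node z)
    bs-ask  : ∀ L a b R l r → Close (#vtx L) (#vtx R) →
              BalancedBST L l → BalancedBST R r →
              BalancedBST (L ++ edg a b ∷ R) (ask a b l r)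

  record St : Set₁ where
    field
      alive : U → Set                 -- nodes of the current tree
      adj   : U → U → Set             -- edges of the current tree (symmetric)
      lst   : U → List (U × U)        -- LST(x): list of queries, asked in order
      bst   : U → U → SearchTree      -- BST(x,y) (oriented from x to y)
      bstIt : U → U → ℕ               -- iteration in which BST(x,y) was created
                                      -- (0 = initial empty BST of T_S)
      contr : U → ℕ                   -- iteration in which x was contracted
                                      -- (0 = not contracted)
  open St public

  init : Rel U 0ℓ → Subset n → St
  init R S = record
    { alive = λ v → v ∈ₛ S
    ; adj   = λ a b → HasseEdge R S a b ⊎ HasseEdge R S b a
    ; lst   = λ _ → []
    ; bst   = λ _ _ → nil
    ; bstIt = λ _ _ → 0
    ; contr = λ _ → 0
    }

  Deg : St → U → ℕ → Set
  Deg s v k = Σ (List U) λ ws →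
    Unique ws × ((w : U) → (w ∈ ws) ⇔ adj s v w) × length ws ≡ k

  record Path : Set where
    constructor path
    field
      x₁  : U
      mid : List U
      xₜ  : U
  open Path public

  pathList : Path → List U
  pathList p = x₁ p ∷ (mid p ++ xₜ p ∷ [])

  MaxPath : St → Path → Set
  MaxPath s p =
    mid p ≢ [] × Unique (pathList p) × All (alive s) (pathList p) ×
    Linked (adj s) (pathList p) × All (λ v → Deg s v 2) (mid p) ×
    ¬ Deg s (x₁ p) 2 × ¬ Deg s (xₜ p) 2

  InMid : List Path → U → Set
  InMid ps v = Any (λ p → v ∈ mid p) ps

  EndPair : List Path → U → U → Set
  EndPair ps a b = Any (λ p → x₁ p ≡ a × xₜ p ≡ b) ps

  LineStep : ℕ → St → St → Set
  LineStep i s m = Σ (List Path) λ ps →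
    All (MaxPath s) ps ×
    ((v : U) → alive s v → Deg s v 2 → InMid ps v) ×
    ((p q : Path) → p ∈ ps → q ∈ ps → (v : U) → v ∈ mid p → v ∈ mid q → p ≡ q) ×
    ((v : U) → alive m v ⇔ (alive s v × ¬ InMid ps v)) ×
    ((a b : U) → adj m a b ⇔
        ((adj s a b × ¬ InMid ps a × ¬ InMid ps b) ⊎ EndPair ps a b ⊎ EndPair ps b a)) ×
    All (λ p → BalancedBST (items (x₁ p) (mid p) (xₜ p)) (bst m (x₁ p) (xₜ p)) ×
               bst m (xₜ p) (x₁ p) ≡ mirror (bst m (x₁ p) (xₜ p)) ×
               bstIt m (x₁ p) (xₜ p) ≡ i × bstIt m (xₜ p) (x₁ p) ≡ i) ps ×
    ((a b : U) → ¬ EndPair ps a b → ¬ EndPair ps b a →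
        bst m a b ≡ bst s a b × bstIt m a b ≡ bstIt s a b) ×
    ((x : U) → lst m x ≡ lst s x) ×
    ((v : U) → (InMid ps v → contr m v ≡ i) × (¬ InMid ps v → contr m v ≡ contr s v))

  -- Leaf contraction in iteration i; rem y: y is removed, into y: the
  -- neighbour x of y whose LST receives the query (x,y)
  LeafStep : ℕ → St → St → Set₁
  LeafStep i m s = Σ (U → Set) λ rem → Σ (U → U) λ into →
    ((y : U) → rem y → alive m y × Deg m y 1 × adj m y (into y) × ¬ rem (into y)) ×
    -- every degree-1 node is removed, except the arbitrarily kept endpoint
    -- when only one edge remains
    ((y : U) → alive m y → Deg m y 1 → rem y ⊎ (Σ U λ z → rem z × into z ≡ y)) ×
    ((v : U) → alive s v ⇔ (alive m v × ¬ rem v)) ×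
    ((a b : U) → adj s a b ⇔ (adj m a b × ¬ rem a × ¬ rem b)) ×
    ((x : U) → Σ (List (U × U)) λ L → lst s x ≡ L ++ lst m x × Unique L ×
        ((q : U × U) → (q ∈ L) ⇔ (Σ U λ y → rem y × into y ≡ x × q ≡ (x , y)))) ×
    ((a b : U) → bst s a b ≡ bst m a b × bstIt s a b ≡ bstIt m a b) ×
    ((v : U) → (rem v → contr s v ≡ i) × (¬ rem v → contr s v ≡ contr m v))

  Iteration : ℕ → St → St → Set₁
  Iteration i s s' = Σ St λ m → LineStep i s m × LeafStep i m s'

  OneNode : St → Set
  OneNode s = Σ U λ r → alive s r × ((v : U) → alive s v → v ≡ r)

  data Run : ℕ → St → St → Set₁ where
    stop : ∀ {i s} → OneNode s → Run i s s
    step : ∀ {i s s' t} → ¬ OneNode s → Iteration i s s' → Run (suc i) s' t → Run i s t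

  -- t is the final state of a Line-Leaf Tree construction from S
  -- (its unique alive node is the root r; the Line-Leaf Tree is rooted at LST(r))
  Built : Rel U 0ℓ → Subset n → St → Set₁
  Built R S t = Run 1 (init R S) t

  data Comp : Set where
    lstC : U → Comp
    bstC : U → U → Comp

  mutual
    -- Visit t c cs : a search entering component c visits the components cs
    -- (starting with c) until it reaches a leaf of the Line-Leaf Tree
    data Visit (t : St) : Comp → List Comp → Set where
      vLST : ∀ {x cs} → InLST t x (lst t x) cs → Visit t (lstC x) (lstC x ∷ cs)
      vBST : ∀ {a b cs} → InBST t (bst t a b) cs → Visit t (bstC a b) (bstC a b ∷ cs)

    data InLST (t : St) (x : U) : List (U × U) → List Comp → Set where
      ret   : InLST t x [] []                          -- queries exhausted: return x
      ansX  : ∀ {q qs cs} → InLST t x qs cs → InLST t x (q ∷ qs) cs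
      ansH  : ∀ {a b qs cs} → Visit t (bstC a b) cs → InLST t x ((a , b) ∷ qs) cs
      ansY  : ∀ {a b qs cs} → Visit t (lstC b) cs → InLST t x ((a , b) ∷ qs) cs

    data InBST (t : St) : SearchTree → List Comp → Set where
      retNil : InBST t nil []
      atNode : ∀ {z cs} → Visit t (lstC z) cs → InBST t (node z) cs
      ansX   : ∀ {a b l r cs} → InBST t l cs → InBST t (ask a b l r) cs
      ansY   : ∀ {a b l r cs} → InBST t r cs → InBST t (ask a b l r) cs
      ansH   : ∀ {a b l r cs} → Visit t (bstC a b) cs → InBST t (ask a b l r) cs

  BSTCreatedIn : St → ℕ → Comp → Set
  BSTCreatedIn t i (lstC _) = Data.Empty.⊥ where import Data.Empty
  BSTCreatedIn t i (bstC a b) = bstIt t a b ≡ i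

  LSTContractedIn : St → ℕ → Comp → Set
  LSTContractedIn t i (lstC x) = contr t x ≡ i
  LSTContractedIn t i (bstC _ _) = Data.Empty.⊥ where import Data.Empty

AtMostOne : {A : Set} → (A → Set) → List A → Set
AtMostOne P xs = (j k : Fin (length xs)) → P (lookup xs j) → P (lookup xs k) → j ≡ k

module Submission where

-- Every component search structure of a Line-Leaf Tree gets a level: LST(x)
-- has level 2·c(x), where c(x) is the iteration in which x was contracted,
-- and a BST created in iteration j has level 2j+1.  The theorem follows from
-- the fact that every move of the search procedure goes to a component of
-- strictly smaller level: the components on a root-to-leaf path then have
-- pairwise distinct levels, so at most one of them is a BST of iteration i
-- (level 2i+1) and at most one is the LST of a node contracted in iteration
-- i (level 2i; the root LST has level 0 and i ≥ 1).
--
-- The descent rests on an invariant of the construction ('Invariant'): a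
-- query (x,y) of LST(x) leads to LST(y), where y was contracted before x,
-- and to BST(x,y), created no later than y was contracted; a BST created in
-- iteration j ends in nodes contracted in iteration j and only asks about
-- pairs whose BSTs were created before j.

open import Defs
open import Level using (0ℓ)
open import Data.Nat using (ℕ; _≤_; _<_; suc; _*_; z≤n; s≤s)
open import Data.Nat.Properties
  using (≤-refl; ≤-reflexive; <-trans; ≤-<-trans; <-≤-trans; n<1+n; n≤1+n;
         m<n⇒m<1+n; <-irrefl; ≤-pred; *-suc; *-monoʳ-≤; *-monoʳ-<; _<?_)
  renaming (_≟_ to _≟ℕ_)
open import Data.Fin using (Fin; zero; suc)
open import Data.Fin.Properties using (_≟_)
open import Data.Fin.Subset using (Subset) renaming (_∈_ to _∈ₛ_)
open import Data.List using (List; []; _∷_; _++_)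
open import Data.List.Membership.Propositional using (_∈_; find)
open import Data.List.Membership.Propositional.Properties
  using (∈-lookup; ∈-++⁺ˡ; ∈-++⁺ʳ)
open import Data.List.Relation.Unary.Any using (here; there; any?)
import Data.List.Relation.Unary.Any as Any
open import Data.List.Relation.Unary.All using (All; []; _∷_)
import Data.List.Relation.Unary.All as All
open import Data.List.Relation.Unary.All.Properties using (++⁺; ++⁻)
open import Data.List.Relation.Unary.Unique.Propositional using (Unique)
open import Data.List.Relation.Unary.AllPairs using (AllPairs; []; _∷_)
open import Data.Product using (Σ; _×_; _,_; proj₁; proj₂; swap; map)
open import Data.Sum using (_⊎_; inj₁; inj₂)
open import Data.Unit using (⊤; tt)
open import Data.Empty using (⊥-elim)
open import Function.Bundles using (_⇔_; Equivalence)
open import Relation.Binary.Core using (Rel)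
open import Relation.Binary.Structures using (IsPartialOrder)
open import Relation.Binary.PropositionalEquality
  using (_≡_; _≢_; refl; sym; trans; cong; subst; subst₂)
open import Relation.Nullary using (¬_; Dec; yes; no)
open import Relation.Nullary.Decidable using (decidable-stable; _×-dec_)

open Equivalence using (to; from)

atMostOne-allPairs : {A : Set} {R : Rel A 0ℓ} {P : A → Set} →
                     (∀ {x y} → P x → P y → ¬ R x y) →
                     ∀ {xs} → AllPairs R xs → AtMostOne P xs
atMostOne-allPairs sep (_ ∷ _) zero zero _ _ = refl
atMostOne-allPairs sep (rs ∷ _) zero (suc k) p₀ pₖ =
  ⊥-elim (sep p₀ pₖ (All.lookup rs (∈-lookup k)))
atMostOne-allPairs sep (rs ∷ _) (suc j) zero pⱼ p₀ =
  ⊥-elim (sep p₀ pⱼ (All.lookup rs (∈-lookup j)))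
atMostOne-allPairs sep (_ ∷ rss) (suc j) (suc k) pⱼ pₖ =
  cong suc (atMostOne-allPairs sep rss j k pⱼ pₖ)

atMostOne-∷ : {A : Set} {P : A → Set} {x : A} {xs : List A} →
              ¬ P x → AtMostOne P xs → AtMostOne P (x ∷ xs)
atMostOne-∷ ¬px amo zero zero _ _ = refl
atMostOne-∷ ¬px amo zero (suc k) px _ = ⊥-elim (¬px px)
atMostOne-∷ ¬px amo (suc j) zero _ px = ⊥-elim (¬px px)
atMostOne-∷ ¬px amo (suc j) (suc k) pⱼ pₖ = cong suc (amo j k pⱼ pₖ)

-- A case distinction on an arbitrary proposition is admissible when the goal
-- is decidable.  (Aliveness and leaf removal are not assumed decidable.)
by-cases : {A G : Set} → Dec G → (A → G) → (¬ A → G) → G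
by-cases G? if-A if-¬A =
  decidable-stable G? (λ ¬g → ¬g (if-¬A (λ a → ¬g (if-A a))))

-- 2a + 1 < 2b whenever a < b; this separates the levels of BSTs and LSTs.
double-suc-< : ∀ {a b} → a < b → suc (2 * a) < 2 * b
double-suc-< {a} {b} a<b = subst (_≤ 2 * b) (*-suc 2 a) (*-monoʳ-≤ 2 a<b)

module _ {n : ℕ} where

  inMid? : (ps : List Path) (v : Fin n) → Dec (InMid ps v)
  inMid? ps v = any? (λ p → any? (v ≟_) (mid p)) ps

  endPair? : (ps : List Path) (a b : Fin n) → Dec (EndPair ps a b)
  endPair? ps a b = any? (λ p → (x₁ p ≟ a) ×-dec (xₜ p ≟ b)) ps

  module MaximalPaths {s : St {n}} {ps : List Path}
                      (maximal : All (MaxPath s) ps) where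

    interior : ∀ {p v} → p ∈ ps → v ∈ mid p → InMid ps v
    interior p∈ v∈ = Any.map (λ { refl → v∈ }) p∈

    interior-facts : ∀ {v} → InMid ps v → alive s v × Deg s v 2
    interior-facts im with find im
    ... | p , p∈ , v∈ with All.lookup maximal p∈
    ...   | _ , _ , alive-p , _ , deg-mid , _ =
      All.lookup alive-p (there (∈-++⁺ˡ v∈)) , All.lookup deg-mid v∈

    endpoint-facts : ∀ {a b} → EndPair ps a b →
                     (alive s a × ¬ Deg s a 2) × (alive s b × ¬ Deg s b 2)
    endpoint-facts e with find e
    ... | p , p∈ , refl , refl with All.lookup maximal p∈
    ...   | _ , _ , alive-p , _ , _ , ¬deg₁ , ¬degₜ =
      (All.lookup alive-p (here refl) , ¬deg₁) ,
      (All.lookup alive-p (there (∈-++⁺ʳ (mid p) (here refl))) , ¬degₜ)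

    endpoints-alive : ∀ {a b} → EndPair ps a b → alive s a × alive s b
    endpoints-alive e = map proj₁ proj₁ (endpoint-facts e)

    endpoints-outside : ∀ {a b} → EndPair ps a b → ¬ InMid ps a × ¬ InMid ps b
    endpoints-outside e =
      (λ im → proj₂ (proj₁ (endpoint-facts e)) (proj₂ (interior-facts im))) ,
      (λ im → proj₂ (proj₂ (endpoint-facts e)) (proj₂ (interior-facts im)))

    interior-not-end : ∀ {a b} → InMid ps a → ¬ EndPair ps a b × ¬ EndPair ps b a
    interior-not-end im = (λ e → proj₁ (endpoints-outside e) im) ,
                          (λ e → proj₂ (endpoints-outside e) im)

    dead-not-end : ∀ {a b} → ¬ (alive s a × alive s b) →
                   ¬ EndPair ps a b × ¬ EndPair ps b a
    dead-not-end ¬ab = (λ e → ¬ab (endpoints-alive e)) ,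
                       (λ e → ¬ab (swap (endpoints-alive e)))

  -- Every item of the path a, ms, b (ms nonempty) is a node of ms or an
  -- edge with an endpoint in ms: the new BST only mentions contracted nodes.
  Touches : List (Fin n) → Item {n} → Set
  Touches M (vtx z) = z ∈ M
  Touches M (edg c d) = c ∈ M ⊎ d ∈ M

  items-touch-from : ∀ {M} a m ms b → a ∈ M ⊎ m ∈ M → All (_∈ M) (m ∷ ms) →
                     All (Touches M) (items a (m ∷ ms) b)
  items-touch-from a m [] b first (m∈ ∷ []) = first ∷ m∈ ∷ inj₁ m∈ ∷ []
  items-touch-from a m (m' ∷ ms) b first (m∈ ∷ ms∈) =
    first ∷ m∈ ∷ items-touch-from m m' ms b (inj₁ m∈) ms∈

  items-touch : ∀ a ms b → ms ≢ [] → All (Touches ms) (items a ms b)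
  items-touch a [] b ne = ⊥-elim (ne refl)
  items-touch a (m ∷ ms) b _ =
    items-touch-from a m ms b (inj₂ (here refl)) (All.tabulate (λ m∈ → m∈))

  BSTGood : St {n} → ℕ → SearchTree {n} → Set
  BSTGood s j nil = ⊤
  BSTGood s j (node z) = ¬ alive s z × contr s z ≡ j
  BSTGood s j (ask c d l r) =
    ¬ (alive s c × alive s d) × bstIt s c d < j × BSTGood s j l × BSTGood s j r

  data GoodItem (s : St {n}) (j : ℕ) : Item {n} → Set where
    good-vtx : ∀ {z} → ¬ alive s z → contr s z ≡ j → GoodItem s j (vtx z)
    good-edg : ∀ {c d} → ¬ (alive s c × alive s d) →
               bstIt s c d < j → bstIt s d c < j → GoodItem s j (edg c d)

  good-edg-flip : ∀ {s j c d} → GoodItem s j (edg c d) → GoodItem s j (edg d c)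
  good-edg-flip (good-edg ¬cd lt lt') = good-edg (λ dc → ¬cd (swap dc)) lt' lt

  balanced-good : ∀ {s j L tr} → BalancedBST L tr → All (GoodItem s j) L →
                  BSTGood s j tr × BSTGood s j (mirror tr)
  balanced-good bs-nil _ = tt , tt
  balanced-good (bs-node z) (good-vtx dead c≡ ∷ []) = (dead , c≡) , (dead , c≡)
  balanced-good (bs-ask L a b R l r _ bl br) goods with ++⁻ L goods
  ... | goodL , good-edg ¬ab lt lt' ∷ goodR
    with balanced-good bl goodL | balanced-good br goodR
  ... | gl , gl' | gr , gr' =
    (¬ab , lt , gl , gr) , ((λ ba → ¬ab (swap ba)) , lt' , gr' , gl')

  record GoodQuery (s : St {n}) (c : ℕ) (x y : Fin n) : Set where
    field
      target-dead  : ¬ alive s y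
      target-early : contr s y < c
      target-below : ¬ alive s x → contr s y < contr s x
      edge-early   : bstIt s x y ≤ contr s y
  open GoodQuery

  QueryOf : St {n} → ℕ → Fin n → Fin n × Fin n → Set
  QueryOf s c x (a , y) = a ≡ x × GoodQuery s c x y

  record Invariant (c e : ℕ) (s : St {n}) : Set where
    field
      adj-alive    : ∀ a b → adj s a b → alive s a × alive s b
      alive-intact : ∀ v → alive s v → contr s v ≡ 0
      lst-good     : ∀ x → All (QueryOf s c x) (lst s x)
      bst-good     : ∀ a b → BSTGood s (bstIt s a b) (bst s a b)
      bst-early    : ∀ a b → bstIt s a b < e
  open Invariant

  init-invariant : ∀ R S → Invariant 1 1 (init {n} R S)
  adj-alive (init-invariant R S) a b (inj₁ ab) = proj₁ ab , proj₁ (proj₂ ab)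
  adj-alive (init-invariant R S) a b (inj₂ ba) = proj₁ (proj₂ ba) , proj₁ ba
  alive-intact (init-invariant R S) v _ = refl
  lst-good (init-invariant R S) x = []
  bst-good (init-invariant R S) a b = tt
  bst-early (init-invariant R S) a b = s≤s z≤n

  record Evolves (c : ℕ) (s s' : St {n}) : Set where
    field
      alive-before : ∀ {v} → alive s' v → alive s v
      alive-contr  : ∀ {v} → alive s' v → contr s' v ≡ contr s v
      killed-contr : ∀ {v} → alive s v → ¬ alive s' v → contr s' v ≡ c
      dead-contr   : ∀ {v} → ¬ alive s v → contr s' v ≡ contr s v
      dead-bstIt   : ∀ {a b} → ¬ (alive s a × alive s b) → bstIt s' a b ≡ bstIt s a b
  open Evolves

  dead-stays-dead : ∀ {c s s'} → Evolves c s s' → ∀ {v} → ¬ alive s v → ¬ alive s' v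
  dead-stays-dead ev dead a = dead (alive-before ev a)

  -- a good BST stays good: its leaves stay dead, its queried pairs untouched
  bst-good-evolves : ∀ {c s s'} → Evolves c s s' → ∀ j tr →
                     BSTGood s j tr → BSTGood s' j tr
  bst-good-evolves ev j nil _ = tt
  bst-good-evolves ev j (node z) (dead , c≡) =
    dead-stays-dead ev dead , trans (dead-contr ev dead) c≡
  bst-good-evolves ev j (ask a b l r) (¬ab , lt , gl , gr) =
    (λ ab → ¬ab (map (alive-before ev) (alive-before ev) ab)) ,
    subst (_< j) (sym (dead-bstIt ev ¬ab)) lt ,
    bst-good-evolves ev j l gl , bst-good-evolves ev j r gr

  -- A stored query stays good; x may be contracted now, i.e. in iteration c,
  -- which is later than the contraction of the query target y.
  query-evolves : ∀ {c c' s s' x} → Evolves c s s' → c ≤ c' → ∀ q →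
                  QueryOf s c x q → QueryOf s' c' x q
  query-evolves {c} {c'} {s} {s'} {x} ev c≤c' (_ , y) (refl , g) = refl , g'
    where
    y-dead : ¬ alive s y
    y-dead = target-dead g
    y≡ : contr s' y ≡ contr s y
    y≡ = dead-contr ev y-dead
    g' : GoodQuery s' c' x y
    target-dead g' = dead-stays-dead ev y-dead
    target-early g' = subst (_< c') (sym y≡) (<-≤-trans (target-early g) c≤c')
    target-below g' x-dead' = subst (_< contr s' x) (sym y≡)
      (by-cases {alive s x} (contr s y <? contr s' x)
        (λ x-alive → subst (contr s y <_) (sym (killed-contr ev x-alive x-dead'))
                       (target-early g))
        (λ x-dead → subst (contr s y <_) (sym (dead-contr ev x-dead))
                       (target-below g x-dead)))
    edge-early g' = subst₂ _≤_ (sym (dead-bstIt ev (λ xy → y-dead (proj₂ xy))))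
                               (sym y≡) (edge-early g)

  lst-evolves : ∀ {c c' s s' x} → Evolves c s s' → c ≤ c' → ∀ {qs} →
                All (QueryOf s c x) qs → All (QueryOf s' c' x) qs
  lst-evolves ev c≤c' = All.map (λ {q} → query-evolves ev c≤c' q)

  module LineContraction
    {i : ℕ} {s m : St {n}} {ps : List Path}
    (maximal : All (MaxPath s) ps)
    (alive⇔ : ∀ v → alive m v ⇔ (alive s v × ¬ InMid ps v))
    (adj⇔ : ∀ a b → adj m a b ⇔ ((adj s a b × ¬ InMid ps a × ¬ InMid ps b) ⊎
                                  EndPair ps a b ⊎ EndPair ps b a))
    (new-bst : All (λ p → BalancedBST (items (x₁ p) (mid p) (xₜ p)) (bst m (x₁ p) (xₜ p)) ×
                          bst m (xₜ p) (x₁ p) ≡ mirror (bst m (x₁ p) (xₜ p)) ×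
                          bstIt m (x₁ p) (xₜ p) ≡ i × bstIt m (xₜ p) (x₁ p) ≡ i) ps)
    (old-bst : ∀ a b → ¬ EndPair ps a b → ¬ EndPair ps b a →
               bst m a b ≡ bst s a b × bstIt m a b ≡ bstIt s a b)
    (lst≡ : ∀ x → lst m x ≡ lst s x)
    (contr≡ : ∀ v → (InMid ps v → contr m v ≡ i) × (¬ InMid ps v → contr m v ≡ contr s v))
    (inv : Invariant i i s)
    where
    open MaximalPaths {s} {ps} maximal

    outside : ∀ {v} → alive m v → ¬ InMid ps v
    outside a = proj₂ (to (alive⇔ _) a)

    endpoints-survive : ∀ {a b} → EndPair ps a b → alive m a × alive m b
    endpoints-survive e =
      from (alive⇔ _) (proj₁ (endpoints-alive e) , proj₁ (endpoints-outside e)) ,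
      from (alive⇔ _) (proj₂ (endpoints-alive e) , proj₂ (endpoints-outside e))

    evolves : Evolves i s m
    alive-before evolves a = proj₁ (to (alive⇔ _) a)
    alive-contr evolves a = proj₂ (contr≡ _) (outside a)
    killed-contr evolves {v} a ¬a with inMid? ps v
    ... | yes im = proj₁ (contr≡ v) im
    ... | no ¬im = ⊥-elim (¬a (from (alive⇔ v) (a , ¬im)))
    dead-contr evolves dead = proj₂ (contr≡ _) (λ im → dead (proj₁ (interior-facts im)))
    dead-bstIt evolves {a} {b} ¬ab =
      proj₂ (old-bst a b (proj₁ (dead-not-end ¬ab)) (proj₂ (dead-not-end ¬ab)))

    -- an edge at an interior node keeps its old BST, created before i
    interior-edge : ∀ {c d} → InMid ps c → GoodItem m i (edg c d)
    interior-edge {c} {d} im = good-edg (λ cd → outside (proj₁ cd) im)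
      (subst (_< i) (sym (proj₂ (old-bst c d ¬cd ¬dc))) (bst-early inv c d))
      (subst (_< i) (sym (proj₂ (old-bst d c ¬dc ¬cd))) (bst-early inv d c))
      where
      ¬cd : ¬ EndPair ps c d
      ¬cd = proj₁ (interior-not-end im)
      ¬dc : ¬ EndPair ps d c
      ¬dc = proj₂ (interior-not-end im)

    path-items-good : ∀ {p} → p ∈ ps → ∀ {it} → Touches (mid p) it → GoodItem m i it
    path-items-good p∈ {vtx z} z∈ =
      good-vtx (λ a → outside a (interior p∈ z∈)) (proj₁ (contr≡ z) (interior p∈ z∈))
    path-items-good p∈ {edg c d} (inj₁ c∈) = interior-edge (interior p∈ c∈)
    path-items-good p∈ {edg c d} (inj₂ d∈) = good-edg-flip (interior-edge (interior p∈ d∈))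

    new-edge : ∀ {a b} → EndPair ps a b → BSTGood m (bstIt m a b) (bst m a b) ×
                                          BSTGood m (bstIt m b a) (bst m b a)
    new-edge e with find e
    ... | p , p∈ , refl , refl
      with All.lookup new-bst p∈ | proj₁ (All.lookup maximal p∈)
    ... | balanced , mirrored , it≡ , it≡' | nonempty
      rewrite it≡ | it≡' | mirrored =
      balanced-good balanced (All.map (path-items-good p∈) (items-touch _ _ _ nonempty))

    new-edge-it : ∀ {a b} → EndPair ps a b → bstIt m a b ≡ i × bstIt m b a ≡ i
    new-edge-it e with find e
    ... | p , p∈ , refl , refl with All.lookup new-bst p∈
    ...   | _ , _ , it≡ , it≡' = it≡ , it≡'

    invariant : Invariant i (suc i) m
    adj-alive invariant a b ab with to (adj⇔ a b) ab
    ... | inj₁ (ab' , ¬a , ¬b) =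
      from (alive⇔ a) (proj₁ (adj-alive inv a b ab') , ¬a) ,
      from (alive⇔ b) (proj₂ (adj-alive inv a b ab') , ¬b)
    ... | inj₂ (inj₁ e) = endpoints-survive e
    ... | inj₂ (inj₂ e) = swap (endpoints-survive e)
    alive-intact invariant v a =
      trans (alive-contr evolves a) (alive-intact inv v (alive-before evolves a))
    lst-good invariant x =
      subst (All (QueryOf m i x)) (sym (lst≡ x)) (lst-evolves evolves ≤-refl (lst-good inv x))
    bst-good invariant a b with endPair? ps a b | endPair? ps b a
    ... | yes e | _ = proj₁ (new-edge e)
    ... | no _ | yes e = proj₂ (new-edge e)
    ... | no ¬e | no ¬e' with old-bst a b ¬e ¬e'
    ...   | bst≡ , it≡ rewrite bst≡ | it≡ =
      bst-good-evolves evolves _ _ (bst-good inv a b)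
    bst-early invariant a b with endPair? ps a b | endPair? ps b a
    ... | yes e | _ = ≤-reflexive (cong suc (proj₁ (new-edge-it e)))
    ... | no _ | yes e = ≤-reflexive (cong suc (proj₂ (new-edge-it e)))
    ... | no ¬e | no ¬e' =
      subst (_< suc i) (sym (proj₂ (old-bst a b ¬e ¬e'))) (m<n⇒m<1+n (bst-early inv a b))

  line-preserves : ∀ {i s m} → LineStep i s m → Invariant i i s → Invariant i (suc i) m
  line-preserves (_ , maximal , _ , _ , alive⇔ , adj⇔ , new-bst , old-bst , lst≡ , contr≡) inv =
    LineContraction.invariant maximal alive⇔ adj⇔ new-bst old-bst lst≡ contr≡ inv

  module LeafContraction
    {i : ℕ} {m s : St {n}} (rem : Fin n → Set) (into : Fin n → Fin n)
    (removed : ∀ y → rem y → alive m y × Deg m y 1 × adj m y (into y) × ¬ rem (into y))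
    (alive⇔ : ∀ v → alive s v ⇔ (alive m v × ¬ rem v))
    (adj⇔ : ∀ a b → adj s a b ⇔ (adj m a b × ¬ rem a × ¬ rem b))
    (lst-new : ∀ x → Σ (List (Fin n × Fin n)) λ L → lst s x ≡ L ++ lst m x ×
                 Unique L ×
                 (∀ q → (q ∈ L) ⇔ (Σ (Fin n) λ y → rem y × into y ≡ x × q ≡ (x , y))))
    (bst≡ : ∀ a b → bst s a b ≡ bst m a b × bstIt s a b ≡ bstIt m a b)
    (contr≡ : ∀ v → (rem v → contr s v ≡ i) × (¬ rem v → contr s v ≡ contr m v))
    (inv : Invariant i (suc i) m)
    where

    survivor : ∀ {v} → alive m v → ¬ rem v → alive s v
    survivor a ¬r = from (alive⇔ _) (a , ¬r)

    not-removed : ∀ {v} → alive s v → ¬ rem v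
    not-removed a = proj₂ (to (alive⇔ _) a)

    evolves : Evolves i m s
    alive-before evolves a = proj₁ (to (alive⇔ _) a)
    alive-contr evolves a = proj₂ (contr≡ _) (not-removed a)
    killed-contr evolves {v} a ¬a = by-cases (contr s v ≟ℕ i) (proj₁ (contr≡ v))
      (λ ¬r → ⊥-elim (¬a (survivor a ¬r)))
    dead-contr evolves dead = proj₂ (contr≡ _) (λ r → dead (proj₁ (removed _ r)))
    dead-bstIt evolves {a} {b} _ = proj₂ (bst≡ a b)

    new-query : ∀ {x y} → rem y → into y ≡ x → QueryOf s (suc i) x (x , y)
    new-query {x} {y} r refl = refl , g
      where
      y≡ : contr s y ≡ i
      y≡ = proj₁ (contr≡ y) r
      x-survives : alive s x
      x-survives = survivor (proj₂ (adj-alive inv y x (proj₁ (proj₂ (proj₂ (removed y r))))))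
                            (proj₂ (proj₂ (proj₂ (removed y r))))
      g : GoodQuery s (suc i) x y
      target-dead g a = not-removed a r
      target-early g = subst (_< suc i) (sym y≡) (n<1+n i)
      target-below g x-dead = ⊥-elim (x-dead x-survives)
      edge-early g =
        subst₂ _≤_ (sym (proj₂ (bst≡ x y))) (sym y≡) (≤-pred (bst-early inv x y))

    LeftBy : Fin n → Fin n × Fin n → Set
    LeftBy x q = Σ (Fin n) λ y → rem y × into y ≡ x × q ≡ (x , y)

    new-queries : ∀ x {L} → (∀ q → (q ∈ L) ⇔ LeftBy x q) → All (QueryOf s (suc i) x) L
    new-queries x L⇔ = All.tabulate λ {q} q∈ → new-query-at (to (L⇔ q) q∈)
      where
      new-query-at : ∀ {q} → LeftBy x q → QueryOf s (suc i) x q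
      new-query-at (y , r , into≡ , refl) = new-query r into≡

    invariant : Invariant (suc i) (suc i) s
    adj-alive invariant a b ab with to (adj⇔ a b) ab
    ... | ab' , ¬ra , ¬rb = survivor (proj₁ (adj-alive inv a b ab')) ¬ra ,
                            survivor (proj₂ (adj-alive inv a b ab')) ¬rb
    alive-intact invariant v a =
      trans (alive-contr evolves a) (alive-intact inv v (alive-before evolves a))
    lst-good invariant x with lst-new x
    ... | L , lst≡ , _ , L⇔ = subst (All (QueryOf s (suc i) x)) (sym lst≡)
      (++⁺ (new-queries x L⇔) (lst-evolves evolves (n≤1+n i) (lst-good inv x)))
    bst-good invariant a b with bst≡ a b
    ... | tree≡ , it≡ rewrite tree≡ | it≡ = bst-good-evolves evolves _ _ (bst-good inv a b)
    bst-early invariant a b = subst (_< suc i) (sym (proj₂ (bst≡ a b))) (bst-early inv a b)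

  leaf-preserves : ∀ {i m s} → LeafStep i m s → Invariant i (suc i) m →
                   Invariant (suc i) (suc i) s
  leaf-preserves (rem , into , removed , _ , alive⇔ , adj⇔ , lst-new , bst≡ , contr≡) inv =
    LeafContraction.invariant rem into removed alive⇔ adj⇔ lst-new bst≡ contr≡ inv

  run-invariant : ∀ {i s t} → Run i s t → Invariant i i s → Σ ℕ λ k → Invariant k k t
  run-invariant (stop _) inv = _ , inv
  run-invariant (step _ (_ , line , leaf) run) inv =
    run-invariant run (leaf-preserves leaf (line-preserves line inv))

  level : St {n} → Comp {n} → ℕ
  level t (lstC x) = 2 * contr t x
  level t (bstC a b) = suc (2 * bstIt t a b)

  Descends : St {n} → Rel (Comp {n}) 0ℓ
  Descends t c d = level t d < level t c

  DescendingBelow : St {n} → ℕ → List (Comp {n}) → Set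
  DescendingBelow t B cs =
    All (λ c → level t c < B) cs × AllPairs (Descends t) cs

  raise : ∀ {t B B' cs} → B ≤ B' → DescendingBelow t B cs → DescendingBelow t B' cs
  raise B≤B' (below , desc) = All.map (λ lt → <-≤-trans lt B≤B') below , desc

  prepend : ∀ {t B c cs} → level t c < B → DescendingBelow t (level t c) cs →
            DescendingBelow t B (c ∷ cs)
  prepend lt (below , desc) = lt ∷ All.map (λ lt' → <-trans lt' lt) below , below ∷ desc

  -- In a state satisfying the invariant, every move of a search lowers the
  -- level.  Only the root LST is entered at an alive node.
  module Descent (t : St {n}) {k : ℕ} (inv : Invariant k k t) where

    Enterable : Comp {n} → Set
    Enterable (lstC x) = ¬ alive t x
    Enterable (bstC a b) = ⊤

    mutual
      visit-descends : ∀ {c cs} → Visit t c cs → Enterable c →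
                       DescendingBelow t (suc (level t c)) cs
      visit-descends (vLST {x} h) x-dead =
        prepend ≤-refl (lst-descends (λ g → target-below g x-dead) (lst-good inv x) h)
      visit-descends (vBST {a} {b} h) _ =
        prepend ≤-refl (bst-descends (bst-good inv a b) h)

      lst-descends : ∀ {x B qs cs} → (∀ {y} → GoodQuery t k x y → contr t y < B) →
                     All (QueryOf t k x) qs → InLST t x qs cs → DescendingBelow t (2 * B) cs
      lst-descends bound _ ret = [] , []
      lst-descends bound (_ ∷ gs) (ansX h) = lst-descends bound gs h
      lst-descends bound ((refl , g) ∷ _) (ansH h) =
        raise (double-suc-< (≤-<-trans (edge-early g) (bound g))) (visit-descends h tt)
      lst-descends bound ((refl , g) ∷ _) (ansY h) =
        raise (*-monoʳ-< 2 (bound g)) (visit-descends h (target-dead g))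

      bst-descends : ∀ {j tr cs} → BSTGood t j tr → InBST t tr cs →
                     DescendingBelow t (suc (2 * j)) cs
      bst-descends _ retNil = [] , []
      bst-descends (z-dead , refl) (atNode h) = visit-descends h z-dead
      bst-descends (_ , _ , gl , _) (ansX h) = bst-descends gl h
      bst-descends (_ , _ , _ , gr) (ansY h) = bst-descends gr h
      bst-descends (_ , lt , _ , _) (ansH h) =
        raise (s≤s (*-monoʳ-< 2 lt)) (visit-descends h tt)

    root-descends : ∀ {r cs} → InLST t r (lst t r) cs →
                    AllPairs (Descends t) cs
    root-descends {r} h = proj₂ (lst-descends target-early (lst-good inv r) h)

  atMostOne-level : ∀ {t v} {P : Comp {n} → Set} → (∀ c → P c → level t c ≡ v) →
                    ∀ {cs} → AllPairs (Descends t) cs → AtMostOne P cs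
  atMostOne-level lv =
    atMostOne-allPairs (λ {c} {d} pc pd lt → <-irrefl (trans (lv d pd) (sym (lv c pc))) lt)

  bst-level : ∀ {t i} c → BSTCreatedIn t i c → level t c ≡ suc (2 * i)
  bst-level (bstC a b) it≡ = cong (λ j → suc (2 * j)) it≡

  lst-level : ∀ {t i} c → LSTContractedIn t i c → level t c ≡ 2 * i
  lst-level (lstC x) c≡ = cong (2 *_) c≡

lemma1 : (n : ℕ) (_≼_ : Rel (Fin n) 0ℓ) → IsPartialOrder _≡_ _≼_ →
         TreeLike _≼_ →
         (ν : Fin n) → ((x : Fin n) → ν ≼ x) →
         (S : Subset n) → ν ∈ₛ S →
         (t : St {n}) → Built _≼_ S t →
         (r : Fin n) → alive t r →
         (cs : List (Comp {n})) → Visit t (lstC r) cs →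
         (i : ℕ) → 1 ≤ i →
         AtMostOne (BSTCreatedIn t i) cs × AtMostOne (LSTContractedIn t i) cs
lemma1 n _≼_ _ _ _ _ S _ t built r r-alive .(lstC r ∷ rest) (vLST {cs = rest} search) i i≥1 =
  atMostOne-∷ {P = BSTCreatedIn t i} (λ ()) bst-once ,
  atMostOne-∷ {P = LSTContractedIn t i} root-intact lst-once
  where
  final : Σ ℕ λ k → Invariant k k t
  final = run-invariant built (init-invariant _≼_ S)
  descending : AllPairs (Descends t) rest
  descending = Descent.root-descends t (proj₂ final) search
  bst-once : AtMostOne (BSTCreatedIn t i) rest
  bst-once = atMostOne-level bst-level descending
  lst-once : AtMostOne (LSTContractedIn t i) rest
  lst-once = atMostOne-level lst-level descending
  -- the root is alive, so its LST has level 0 and was not contracted in i ≥ 1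
  root-intact : ¬ LSTContractedIn t i (lstC r)
  root-intact r≡i =
    <-irrefl (trans (sym (Invariant.alive-intact (proj₂ final) r r-alive)) r≡i) i≥1
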